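{- Fix integers $k,r\ge 1$ and $n\ge 0$. Then the Raney number $R_{k,r}(n)=\frac{r}{kn+r}\binom{kn+r}{n}$ equals the number of ordered $r$-tuples $(T_1,\dots,T_r)$ for which there exist nonnegative integers $i_1,\dots,i_r$ with $i_1+\dots+i_r=n$ and $T_j\in \mathrm{SVT}(i_j^2,\rho)$ for each $j$, where $\rho$ is the row-constant density with $\rho_{1,c}=1$ and $\rho_{2,c}=k-1$ for every column $c$.
   Context: For $m\ge 0$, $m^2$ denotes the two-row rectangular shape with two rows of length $m$ (cell $(i,c)$ is in row $i$, column $c$). A density $\rho$ assigns a nonnegative integer $\rho_{i,c}$ to each cell; with $N=\sum\rho_{i,c}$, a standard set-valued Young tableau of shape $m^2$ and density $\rho$ is an assignment to each cell $(i,c)$ of a set of exactly $\rho_{i,c}$ integers, these sets partitioning $\{1,\dots,N\}$, such that every integer in cell $(i,c)$ is smaller than every integer in cells $(i,c+1)$ and $(i+1,c)$ when these exist. $\mathrm{SVT}(m^2,\rho)$ is the set of such tableaux; for $m=0$ it consists of the single empty tableau. -}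

module Defs where

open import Data.Nat using (ℕ; zero; suc; _+_; _*_; _∸_)
open import Data.Nat.Combinatorics using (_C_)
open import Data.Fin using (Fin; toℕ; _<_; _≟_)
open import Data.Fin.Properties using () renaming (_≟_ to _≟ᶠ_)
open import Data.Product using (Σ; _×_; _,_; proj₁)
open import Data.Product.Properties using (≡-dec)
open import Data.Sum using (_⊎_)
open import Data.Vec using (Vec; lookup; count; tabulate; sum; map)
open import Data.Vec.Relation.Unary.All using (All)
open import Data.List using (List; length)
open import Data.List.Relation.Unary.All using () renaming (All to ListAll)
open import Data.List.Membership.Propositional using (_∈_)
open import Data.List.Relation.Unary.Unique.Propositional using (Unique)
open import Relation.Binary.PropositionalEquality using (_≡_)
open import Relation.Nullary using (Dec)

-- Cells of the two-row rectangle m^2: (row , column), rows 0 (top) and 1 (bottom),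
-- columns 0 .. m-1.
Cell : ℕ → Set
Cell m = Fin 2 × Fin m

_≟Cell_ : ∀ {m} (x y : Cell m) → Dec (x ≡ y)
_≟Cell_ = ≡-dec _≟ᶠ_ _≟ᶠ_

Density : ℕ → Set
Density m = Cell m → ℕ

total : (m : ℕ) → Density m → ℕ
total m ρ = sum (tabulate {n = 2} λ i → sum (tabulate {n = m} λ c → ρ (i , c)))

-- A set-valued tableau is encoded by recording, for each integer a ∈ {1..N}
-- (represented as a : Fin N, i.e. a+1), the cell whose set contains it.
-- Then the sets partition {1..N} automatically; the set in cell x is
-- { a | lookup T a ≡ x }.
IsSVT : (m : ℕ) (ρ : Density m) → Vec (Cell m) (total m ρ) → Set
IsSVT m ρ T =
  ((x : Cell m) → count (λ y → y ≟Cell x) T ≡ ρ x)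
  ×
  ((a b : Fin (total m ρ)) (i j : Fin 2) (c d : Fin m) →
     lookup T a ≡ (i , c) → lookup T b ≡ (j , d) →
     ((i ≡ j × toℕ d ≡ suc (toℕ c)) ⊎ (toℕ j ≡ suc (toℕ i) × c ≡ d)) →
     a < b)

rowDensity : (k m : ℕ) → Density m
rowDensity k m (i , c) with toℕ i
... | zero  = 1
... | suc _ = k ∸ 1

-- Underlying data of an ordered r-tuple of tableaux T_j ∈ SVT(i_j^2, ρ):
-- each entry is (i_j , encoding of T_j).
TupleData : (k r : ℕ) → Set
TupleData k r = Vec (Σ ℕ λ m → Vec (Cell m) (total m (rowDensity k m))) r

Admissible : (k r n : ℕ) → TupleData k r → Set
Admissible k r n t =
  All (λ e → IsSVT (proj₁ e) (rowDensity k (proj₁ e)) (Σ.proj₂ e)) t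
  × sum (map proj₁ t) ≡ n

-- "The number of admissible tuples is N": a duplicate-free list enumerating
-- exactly the admissible tuples, of length N.
CountIs : (k r n : ℕ) → ℕ → Set
CountIs k r n N =
  Σ (List (TupleData k r)) λ L →
    Unique L × ListAll (Admissible k r n) L
    × ((t : TupleData k r) → Admissible k r n t → t ∈ L)
    × length L ≡ N

module Submission where

-- Write k = K + 1 and let ρ put 1 entry in each top cell and K in each bottom
-- cell.  A tableau is encoded by its reading word, the sequence of cells holding
-- 1, 2, …, N.  ReadingCharacterisation shows that these words are exactly the
-- words that can be written letter by letter, each letter going to a cell that
-- still has room and whose predecessors are already full.  For the density ρ
-- such a word is a choice of row for each successive entry; Enumeration lists
-- the words by recursion on the slack d (bottom entries placeable now) and the
-- number a of top entries still to come, and its count obeys the recurrence of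
-- R(d+1, a) defined in Raney.  Hence |SVT(m², ρ)| = R(1, m).  Tuples lists the
-- admissible r-tuples block by block on the size of the first shape, and
-- Raney's convolution identity Σ R(p,a)·R(q,n−a) = R(p+q,n) counts R(r, n) of
-- them.  The closed form (kn + r)·R(r,n) = r·C(kn+r, n), proved from Pascal's
-- rule and the absorption identity, then gives the theorem.

open import Defs
open import Data.Nat using (ℕ; zero; suc; _+_; _*_; _∸_; _≤_; _<_; z≤n; s≤s; s≤s⁻¹)
open import Data.Nat.Properties
open import Algebra.Properties.CommutativeSemigroup +-commutativeSemigroup using () renaming (interchange to +-interchange)
open import Data.Nat.Combinatorics using (_C_; nC1≡n; k>n⇒nCk≡0; nCk+nC[k+1]≡[n+1]C[k+1])
open import Data.Nat.Tactic.RingSolver using (solve-∀)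
open import Data.Fin using (Fin; zero; suc; toℕ; inject₁) renaming (_<_ to _<ᶠ_)
open import Data.Fin.Properties using (toℕ<n; toℕ-inject₁)
open import Data.Product using (Σ; _×_; _,_; proj₁; proj₂; ∃)
open import Data.Sum using (_⊎_; inj₁; inj₂)
open import Data.Vec using (Vec; []; _∷_; lookup; count; tabulate)
import Data.Vec as Vec
import Data.Vec.Relation.Unary.All as VecAll
open import Data.List using (List; []; _∷_; map; _++_; length; cartesianProductWith)
open import Data.List.Properties using (length-++; length-map; ++-identityʳ)
open import Data.List.Membership.Propositional using (_∈_)
open import Data.List.Membership.Propositional.Properties
  using (∈-map⁺; ∈-map⁻; ∈-++⁺ˡ; ∈-++⁺ʳ; ∈-++⁻; ∈-cartesianProductWith⁺; ∈-cartesianProductWith⁻)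
open import Data.List.Relation.Unary.Any using (here)
import Data.List.Relation.Unary.All as ListAll
import Data.List.Relation.Unary.AllPairs as AllPairs
open import Data.List.Relation.Unary.Unique.Propositional using (Unique)
import Data.List.Relation.Unary.Unique.Propositional.Properties as Unique
open import Data.Vec.Properties using (∷-injectiveʳ)
open import Data.Empty using (⊥; ⊥-elim)
open import Relation.Binary using (DecidableEquality; tri<; tri≈; tri>)
open import Relation.Nullary using (Dec; yes; no; ¬_)
open import Function using (_∘_)
open import Relation.Binary.PropositionalEquality
open ≡-Reasoning

absorption : ∀ m j → suc j * (suc m C suc j) ≡ suc m * (m C j)
absorption zero zero = refl
absorption zero (suc j) = begin
    suc (suc j) * (1 C suc (suc j)) ≡⟨ cong (suc (suc j) *_) (k>n⇒nCk≡0 {1} {suc (suc j)} (s≤s (s≤s z≤n))) ⟩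
    suc (suc j) * 0                 ≡⟨ *-zeroʳ (suc (suc j)) ⟩
    0                               ≡⟨ sym (+-identityʳ (0 C suc j)) ⟩
    1 * (0 C suc j)                 ∎
absorption (suc m) zero = begin
    1 * (suc (suc m) C 1) ≡⟨ *-identityˡ _ ⟩
    suc (suc m) C 1       ≡⟨ nC1≡n (suc (suc m)) ⟩
    suc (suc m)           ≡⟨ sym (*-identityʳ _) ⟩
    suc (suc m) * 1       ∎
absorption (suc m) (suc j) = begin
    suc (suc j) * (suc (suc m) C suc (suc j))
      ≡⟨ cong (suc (suc j) *_) (sym (nCk+nC[k+1]≡[n+1]C[k+1] (suc m) (suc j))) ⟩
    suc (suc j) * (X + Y)
      ≡⟨ regroup j X Y ⟩
    (suc j * X + X) + suc (suc j) * Y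
      ≡⟨ cong₂ (λ a b → (a + X) + b) (absorption m j) (absorption m (suc j)) ⟩
    (suc m * (m C j) + X) + suc m * (m C suc j)
      ≡⟨ collect m (m C j) X (m C suc j) ⟩
    suc m * ((m C j) + (m C suc j)) + X
      ≡⟨ cong (λ z → suc m * z + X) (nCk+nC[k+1]≡[n+1]C[k+1] m j) ⟩
    suc m * X + X
      ≡⟨ +-comm (suc m * X) X ⟩
    suc (suc m) * X ∎
  where
  X = suc m C suc j
  Y = suc m C suc (suc j)
  regroup : ∀ j X Y → suc (suc j) * (X + Y) ≡ (suc j * X + X) + suc (suc j) * Y
  regroup = solve-∀
  collect : ∀ m a X b → (suc m * a + X) + suc m * b ≡ suc m * (a + b) + X
  collect = solve-∀

sumTo : ℕ → (ℕ → ℕ) → ℕ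
sumTo zero    f = f 0
sumTo (suc n) f = f 0 + sumTo n (f ∘ suc)

sumTo-cong : ∀ n {f g : ℕ → ℕ} → (∀ a → f a ≡ g a) → sumTo n f ≡ sumTo n g
sumTo-cong zero    f≗g = f≗g 0
sumTo-cong (suc n) f≗g = cong₂ _+_ (f≗g 0) (sumTo-cong n (f≗g ∘ suc))

sumTo-+ : ∀ n (f g : ℕ → ℕ) → sumTo n (λ a → f a + g a) ≡ sumTo n f + sumTo n g
sumTo-+ zero    f g = refl
sumTo-+ (suc n) f g = begin
    (f 0 + g 0) + sumTo n (λ a → f (suc a) + g (suc a))
      ≡⟨ cong ((f 0 + g 0) +_) (sumTo-+ n (f ∘ suc) (g ∘ suc)) ⟩
    (f 0 + g 0) + (sumTo n (f ∘ suc) + sumTo n (g ∘ suc))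
      ≡⟨ +-interchange (f 0) (g 0) _ _ ⟩
    (f 0 + sumTo n (f ∘ suc)) + (g 0 + sumTo n (g ∘ suc)) ∎

sumTo-zero : ∀ n → sumTo n (λ _ → 0) ≡ 0
sumTo-zero zero    = refl
sumTo-zero (suc n) = sumTo-zero n

module Raney (K : ℕ) where

  k : ℕ
  k = suc K

  -- R p n is determined by R(p,0) = 1, R(0,n+1) = 0 and
  -- R(p+1,n+1) = R(p,n+1) + R(p+1+K,n); the closed form below shows that
  -- R p n is the Raney number R_{k,p}(n).
  R : ℕ → ℕ → ℕ
  R zero    zero    = 1
  R zero    (suc n) = 0
  R (suc p) zero    = R p zero
  R (suc p) (suc n) = R p (suc n) + R (suc p + K) n

  R-zero : ∀ p → R p 0 ≡ 1
  R-zero zero    = refl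
  R-zero (suc p) = R-zero p

  -- Write
  -- A = k(n+1)+s, X = C(A,n+1), Y = C(A,n), Z = C(A+1,n+1).  Pascal's rule
  -- (Y + X = Z) and absorption ((n+1)Z = (A+1)Y) give this identity.
  step-identity : ∀ n s X Y Z → Y + X ≡ Z → suc n * Z ≡ suc (k * suc n + s) * Y →
    suc n * (s * X + (suc s + K) * Y) ≡ (k * suc n + s) * suc s * Y
  step-identity n s X Y Z pascal absorb = +-cancelʳ-≡ (suc n * s * Y) _ _ (begin
      suc n * (s * X + (suc s + K) * Y) + suc n * s * Y
        ≡⟨ expand n s X Y K ⟩
      s * (suc n * (Y + X)) + suc n * (suc s + K) * Y
        ≡⟨ cong (λ z → s * (suc n * z) + suc n * (suc s + K) * Y) pascal ⟩
      s * (suc n * Z) + suc n * (suc s + K) * Y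
        ≡⟨ cong (λ z → s * z + suc n * (suc s + K) * Y) absorb ⟩
      s * (suc (k * suc n + s) * Y) + suc n * (suc s + K) * Y
        ≡⟨ contract K n s Y ⟩
      (k * suc n + s) * suc s * Y + suc n * s * Y ∎)
    where
    expand : ∀ n s X Y K → suc n * (s * X + (suc s + K) * Y) + suc n * s * Y
                           ≡ s * (suc n * (Y + X)) + suc n * (suc s + K) * Y
    expand = solve-∀
    contract : ∀ K n s Y → s * (suc (suc K * suc n + s) * Y) + suc n * (suc s + K) * Y
                           ≡ (suc K * suc n + s) * suc s * Y + suc n * s * Y
    contract = solve-∀

  -- The induction step itself: from the closed form for (s, n+1) and for
  -- (s+k, n), derive it for (s+1, n+1), cancelling the nonzero factor A(n+1).
  closed-form-step : ∀ n s F₁ F₂ X Y Z → let A = k * suc n + s in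
    A * F₁ ≡ s * X → A * F₂ ≡ (suc s + K) * Y → Y + X ≡ Z → suc n * Z ≡ suc A * Y →
    suc A * (F₁ + F₂) ≡ suc s * Z
  closed-form-step n s F₁ F₂ X Y Z hyp₁ hyp₂ pascal absorb =
    *-cancelˡ-≡ _ _ (A * suc n) (begin
      A * suc n * (suc A * (F₁ + F₂))       ≡⟨ distribute A n F₁ F₂ ⟩
      suc n * suc A * (A * F₁ + A * F₂)     ≡⟨ cong₂ (λ a b → suc n * suc A * (a + b)) hyp₁ hyp₂ ⟩
      suc n * suc A * (s * X + (suc s + K) * Y)
        ≡⟨ reassoc (suc n) (suc A) (s * X + (suc s + K) * Y) ⟩
      suc A * (suc n * (s * X + (suc s + K) * Y))
        ≡⟨ cong (suc A *_) (step-identity n s X Y Z pascal absorb) ⟩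
      suc A * (A * suc s * Y)               ≡⟨ left-comm (suc A) (A * suc s) Y ⟩
      A * suc s * (suc A * Y)               ≡⟨ cong (A * suc s *_) (sym absorb) ⟩
      A * suc s * (suc n * Z)               ≡⟨ swap A s n Z ⟩
      A * suc n * (suc s * Z)               ∎)
    where
    A = k * suc n + s
    distribute : ∀ A n F₁ F₂ → A * suc n * (suc A * (F₁ + F₂)) ≡ suc n * suc A * (A * F₁ + A * F₂)
    distribute = solve-∀
    reassoc : ∀ a b c → a * b * c ≡ b * (a * c)
    reassoc = solve-∀
    left-comm : ∀ a b c → a * (b * c) ≡ b * (a * c)
    left-comm = solve-∀
    swap : ∀ A s n Z → A * suc s * (suc n * Z) ≡ A * suc n * (suc s * Z)
    swap = solve-∀

  R-closed-form : ∀ n r → (k * n + r) * R r n ≡ r * ((k * n + r) C n)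
  R-closed-form zero    r       rewrite R-zero r | *-zeroʳ k = refl
  R-closed-form (suc n) zero    = *-zeroʳ (k * suc n + 0)
  R-closed-form (suc n) (suc s) = begin
      (k * suc n + suc s) * (R s (suc n) + R (suc s + K) n)
        ≡⟨ cong (_* (R s (suc n) + R (suc s + K) n)) (+-suc (k * suc n) s) ⟩
      suc A * (R s (suc n) + R (suc s + K) n)
        ≡⟨ closed-form-step n s _ _ _ _ _ (R-closed-form (suc n) s) hyp₂
             (nCk+nC[k+1]≡[n+1]C[k+1] A n) (absorption A n) ⟩
      suc s * (suc A C suc n)
        ≡⟨ cong (λ z → suc s * (z C suc n)) (sym (+-suc (k * suc n) s)) ⟩
      suc s * ((k * suc n + suc s) C suc n) ∎
    where
    A = k * suc n + s
    shift : k * n + (suc s + K) ≡ A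
    shift = normalise K n s
      where normalise : ∀ K n s → suc K * n + (suc s + K) ≡ suc K * suc n + s
            normalise = solve-∀
    hyp₂ : A * R (suc s + K) n ≡ (suc s + K) * (A C n)
    hyp₂ = subst (λ z → z * R (suc s + K) n ≡ (suc s + K) * (z C n)) shift
                 (R-closed-form n (suc s + K))

  -- Raney's convolution identity: Σ_{a ≤ n} R(p,a)·R(q,n−a) = R(p+q,n).
  -- It shows that R r n counts r-tuples of objects counted by R 1.
  R-convolution : ∀ p q n → sumTo n (λ a → R p a * R q (n ∸ a)) ≡ R (p + q) n
  R-convolution p q zero rewrite R-zero p | R-zero q | R-zero (p + q) = refl
  R-convolution zero q (suc n) = begin
      1 * R q (suc n) + sumTo n (λ _ → 0) ≡⟨ cong₂ _+_ (*-identityˡ _) (sumTo-zero n) ⟩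
      R q (suc n) + 0                     ≡⟨ +-identityʳ _ ⟩
      R q (suc n)                         ∎
  R-convolution (suc p) q (suc n) = begin
      R p 0 * R q (suc n) + sumTo n (λ a → (R p (suc a) + R (suc p + K) a) * R q (n ∸ a))
        ≡⟨ cong (R p 0 * R q (suc n) +_) split ⟩
      R p 0 * R q (suc n) + (sumTo n (λ a → R p (suc a) * R q (n ∸ a)) + sumTo n (λ a → R (suc p + K) a * R q (n ∸ a)))
        ≡⟨ sym (+-assoc (R p 0 * R q (suc n)) _ _) ⟩
      sumTo (suc n) (λ a → R p a * R q (suc n ∸ a)) + sumTo n (λ a → R (suc p + K) a * R q (n ∸ a))
        ≡⟨ cong₂ _+_ (R-convolution p q (suc n)) (R-convolution (suc p + K) q n) ⟩
      R (p + q) (suc n) + R (suc p + K + q) n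
        ≡⟨ cong (λ z → R (p + q) (suc n) + R z n) (reorder p K q) ⟩
      R (suc p + q) (suc n) ∎
    where
    split : sumTo n (λ a → (R p (suc a) + R (suc p + K) a) * R q (n ∸ a))
          ≡ sumTo n (λ a → R p (suc a) * R q (n ∸ a)) + sumTo n (λ a → R (suc p + K) a * R q (n ∸ a))
    split = trans (sumTo-cong n (λ a → *-distribʳ-+ (R q (n ∸ a)) (R p (suc a)) (R (suc p + K) a)))
                  (sumTo-+ n _ _)
    reorder : ∀ p K q → suc p + K + q ≡ suc (p + q) + K
    reorder = solve-∀

module Occurrences {A : Set} (_≟ᴬ_ : DecidableEquality A) where

  occ : ∀ {n} → A → Vec A n → ℕ
  occ x = count (_≟ᴬ x)

  occ-here : ∀ {n} x (xs : Vec A n) → occ x (x ∷ xs) ≡ suc (occ x xs)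
  occ-here x xs with x ≟ᴬ x
  ... | yes _  = refl
  ... | no x≢x = ⊥-elim (x≢x refl)

  occ-there : ∀ {n} {x y} (xs : Vec A n) → x ≢ y → occ y (x ∷ xs) ≡ occ y xs
  occ-there {x = x} {y} xs x≢y with x ≟ᴬ y
  ... | yes x≡y = ⊥-elim (x≢y x≡y)
  ... | no _    = refl

  lookup⇒occ : ∀ {n} (xs : Vec A n) i → 1 ≤ occ (lookup xs i) xs
  lookup⇒occ (x ∷ xs) zero    rewrite occ-here x xs = s≤s z≤n
  lookup⇒occ (x ∷ xs) (suc i) with x ≟ᴬ lookup xs i
  ... | yes _ = s≤s z≤n
  ... | no _  = lookup⇒occ xs i

  occ⇒lookup : ∀ {n} (xs : Vec A n) x → 1 ≤ occ x xs → ∃ λ i → lookup xs i ≡ x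
  occ⇒lookup (y ∷ xs) x pos with y ≟ᴬ x
  ... | yes y≡x = zero , y≡x
  ... | no _    = let (i , eq) = occ⇒lookup xs x pos in suc i , eq

-- The order relation of IsSVT: every entry of y is smaller than every entry
-- of x, because x is the right or the lower neighbour of y.
_⋖_ : ∀ {m} → Cell m → Cell m → Set
(i , c) ⋖ (j , d) = (i ≡ j × toℕ d ≡ suc (toℕ c)) ⊎ (toℕ j ≡ suc (toℕ i) × c ≡ d)

Increasing : ∀ {m n} → Vec (Cell m) n → Set
Increasing {m} {n} T = (a b : Fin n) (i j : Fin 2) (c d : Fin m) →
  lookup T a ≡ (i , c) → lookup T b ≡ (j , d) → (i , c) ⋖ (j , d) → a <ᶠ b

⋖-irrefl : ∀ {m} (x : Cell m) → ¬ (x ⋖ x)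
⋖-irrefl x (inj₁ (_ , eq)) = 1+n≢n (sym eq)
⋖-irrefl x (inj₂ (eq , _)) = 1+n≢n (sym eq)

removeFrom : ∀ {m} → Density m → Cell m → Density m
removeFrom ρ x y with y ≟Cell x
... | yes _ = ρ y ∸ 1
... | no _  = ρ y

removeFrom-at : ∀ {m} (ρ : Density m) {x y} → y ≡ x → removeFrom ρ x y ≡ ρ y ∸ 1
removeFrom-at ρ {x} {y} y≡x with y ≟Cell x
... | yes _   = refl
... | no y≢x  = ⊥-elim (y≢x y≡x)

removeFrom-off : ∀ {m} (ρ : Density m) {x y} → y ≢ x → removeFrom ρ x y ≡ ρ y
removeFrom-off ρ {x} {y} y≢x with y ≟Cell x
... | yes y≡x = ⊥-elim (y≢x y≡x)
... | no _    = refl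

_≗ᵨ_ : ∀ {m} → Density m → Density m → Set
ρ ≗ᵨ σ = ∀ y → ρ y ≡ σ y

removeFrom-resp : ∀ {m} {ρ σ : Density m} x → ρ ≗ᵨ σ → removeFrom ρ x ≗ᵨ removeFrom σ x
removeFrom-resp x ρ≗σ y with y ≟Cell x
... | yes _ = cong (_∸ 1) (ρ≗σ y)
... | no _  = ρ≗σ y

-- A tableau of density ρ is read as the word T whose a-th letter is the cell
-- containing a.
Reading : ∀ {m n} → Density m → Vec (Cell m) n → Set
Reading ρ []      = ∀ y → ρ y ≡ 0
Reading ρ (x ∷ T) = 1 ≤ ρ x × (∀ y → y ⋖ x → ρ y ≡ 0) × Reading (removeFrom ρ x) T

Reading-resp : ∀ {m n} {ρ σ : Density m} → ρ ≗ᵨ σ → (T : Vec (Cell m) n) → Reading ρ T → Reading σ T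
Reading-resp ρ≗σ []      empty = λ y → trans (sym (ρ≗σ y)) (empty y)
Reading-resp ρ≗σ (x ∷ T) (room , full , rest) =
  subst (1 ≤_) (ρ≗σ x) room ,
  (λ y y⋖x → trans (sym (ρ≗σ y)) (full y y⋖x)) ,
  Reading-resp (removeFrom-resp x ρ≗σ) T rest

module ReadingCharacterisation {m : ℕ} where
  open Occurrences (_≟Cell_ {m})

  reading⇒content : ∀ {n} (ρ : Density m) (T : Vec (Cell m) n) → Reading ρ T → ∀ y → occ y T ≡ ρ y
  reading⇒content ρ []      empty y = sym (empty y)
  reading⇒content ρ (x ∷ T) (room , _ , rest) y with x ≟Cell y
  ... | yes refl = begin
        suc (occ x T)         ≡⟨ cong suc (reading⇒content _ T rest x) ⟩
        suc (removeFrom ρ x x) ≡⟨ cong suc (removeFrom-at ρ refl) ⟩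
        suc (ρ x ∸ 1)         ≡⟨ m+[n∸m]≡n room ⟩
        ρ x                   ∎
  ... | no x≢y = trans (reading⇒content _ T rest y) (removeFrom-off ρ (x≢y ∘ sym))

  reading⇒increasing : ∀ {n} (ρ : Density m) (T : Vec (Cell m) n) → Reading ρ T → Increasing T
  reading⇒increasing ρ (x ∷ T) _ zero zero i j c d refl refl ic⋖jd = ⊥-elim (⋖-irrefl x ic⋖jd)
  reading⇒increasing ρ (x ∷ T) _ zero (suc b) _ _ _ _ _ _ _ = s≤s z≤n
  reading⇒increasing ρ (x ∷ T) (_ , full , rest) (suc a) zero i j c d Ta≡ic refl ic⋖x =
    ⊥-elim (1+n≰n (subst (1 ≤_) exhausted (lookup⇒occ T a)))
    where
    -- the cell (i,c) precedes the first letter x, so none of its entries is left for T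
    exhausted : occ (lookup T a) T ≡ 0
    exhausted = begin
      occ (lookup T a) T          ≡⟨ cong (λ z → occ z T) Ta≡ic ⟩
      occ (i , c) T               ≡⟨ reading⇒content _ T rest (i , c) ⟩
      removeFrom ρ x (i , c)      ≡⟨ removeFrom-off ρ (λ ic≡x → ⋖-irrefl x (subst (_⋖ x) ic≡x ic⋖x)) ⟩
      ρ (i , c)                   ≡⟨ full (i , c) ic⋖x ⟩
      0                           ∎
  reading⇒increasing ρ (x ∷ T) (_ , _ , rest) (suc a) (suc b) i j c d Ta Tb ic⋖jd =
    s≤s (reading⇒increasing _ T rest a b i j c d Ta Tb ic⋖jd)

  reading⇒svt : ∀ (ρ : Density m) (T : Vec (Cell m) (total m ρ)) → Reading ρ T → IsSVT m ρ T
  reading⇒svt ρ T r = reading⇒content ρ T r , reading⇒increasing ρ T r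

  content∧increasing⇒reading : ∀ {n} (ρ : Density m) (T : Vec (Cell m) n) →
    (∀ y → occ y T ≡ ρ y) → Increasing T → Reading ρ T
  content∧increasing⇒reading ρ []      content _   y = sym (content y)
  content∧increasing⇒reading ρ (x ∷ T) content inc = room , full , rest
    where
    room : 1 ≤ ρ x
    room = subst (1 ≤_) (trans (sym (occ-here x T)) (content x)) (s≤s z≤n)
    -- a cell y ⋖ x cannot occur after x, and it cannot be x itself
    full : ∀ y → y ⋖ x → ρ y ≡ 0
    full y y⋖x with occ y T in eq
    ... | zero  = trans (sym (content y)) (trans (occ-there T (λ x≡y → ⋖-irrefl y (subst (y ⋖_) x≡y y⋖x))) eq)
    ... | suc _ with occ⇒lookup T y (subst (1 ≤_) (sym eq) (s≤s z≤n))
    ...   | a , Ta≡y with inc (suc a) zero (proj₁ y) (proj₁ x) (proj₂ y) (proj₂ x) Ta≡y refl y⋖x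
    ...     | ()
    content-rest : ∀ y → occ y T ≡ removeFrom ρ x y
    content-rest y with y ≟Cell x
    ... | yes refl = cong (_∸ 1) (trans (sym (occ-here x T)) (content x))
    ... | no y≢x   = trans (sym (occ-there T (y≢x ∘ sym))) (content y)
    rest : Reading (removeFrom ρ x) T
    rest = content∧increasing⇒reading _ T content-rest
             (λ a b i j c d Ta Tb ic⋖jd → s≤s⁻¹ (inc (suc a) (suc b) i j c d Ta Tb ic⋖jd))

  svt⇒reading : ∀ (ρ : Density m) (T : Vec (Cell m) (total m ρ)) → IsSVT m ρ T → Reading ρ T
  svt⇒reading ρ T (content , inc) = content∧increasing⇒reading ρ T content inc

saturate : (M : ℕ) → ℕ → Fin (suc M)
saturate M       zero    = zero
saturate zero    (suc p) = zero
saturate (suc M) (suc p) = suc (saturate M p)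

toℕ-saturate : ∀ M p → p ≤ M → toℕ (saturate M p) ≡ p
toℕ-saturate M       zero    _         = refl
toℕ-saturate (suc M) (suc p) (s≤s p≤M) = cong suc (toℕ-saturate M p p≤M)

saturate-toℕ : ∀ {M} (e : Fin (suc M)) → saturate M (toℕ e) ≡ e
saturate-toℕ          zero    = refl
saturate-toℕ {suc M} (suc e) = cong suc (saturate-toℕ e)

lowerAt : ℕ → (ℕ → ℕ) → ℕ → ℕ
lowerAt p f x with x ≟ p
... | yes _ = f x ∸ 1
... | no  _ = f x

lowerAt-at : ∀ p x f → x ≡ p → lowerAt p f x ≡ f x ∸ 1
lowerAt-at p x f x≡p with x ≟ p
... | yes _   = refl
... | no x≢p  = ⊥-elim (x≢p x≡p)

lowerAt-off : ∀ p x f → x ≢ p → lowerAt p f x ≡ f x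
lowerAt-off p x f x≢p with x ≟ p
... | yes x≡p = ⊥-elim (x≢p x≡p)
... | no _    = refl

byRows : ∀ {m} → (ℕ → ℕ) → (ℕ → ℕ) → Density m
byRows f g (zero     , x) = f (toℕ x)
byRows f g (suc zero , x) = g (toℕ x)

byRows-cong : ∀ {m} {f f′ g g′ : ℕ → ℕ} → (∀ x → f x ≡ f′ x) → (∀ x → g x ≡ g′ x) →
  byRows {m} f g ≗ᵨ byRows f′ g′
byRows-cong f≗f′ g≗g′ (zero     , x) = f≗f′ (toℕ x)
byRows-cong f≗f′ g≗g′ (suc zero , x) = g≗g′ (toℕ x)

sameColumn : ∀ {M} {e : Fin (suc M)} {p} → toℕ e ≡ p → e ≡ saturate M p
sameColumn {e = e} refl = sym (saturate-toℕ e)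

columnOf : ∀ {M} {i j : Fin 2} {e : Fin (suc M)} {p} → p ≤ M → (i , e) ≡ (j , saturate M p) → toℕ e ≡ p
columnOf {M} {p = p} p≤M refl = toℕ-saturate M p p≤M

removeFrom-inRow : ∀ {M} (ρ : Density (suc M)) i {p} → p ≤ M → (h : ℕ → ℕ) →
  (∀ e → ρ (i , e) ≡ h (toℕ e)) → ∀ e → removeFrom ρ (i , saturate M p) (i , e) ≡ lowerAt p h (toℕ e)
removeFrom-inRow {M} ρ i {p} p≤M h ρ≡h e = byColumn (toℕ e ≟ p)
  where
  byColumn : Dec (toℕ e ≡ p) → removeFrom ρ (i , saturate M p) (i , e) ≡ lowerAt p h (toℕ e)
  byColumn (yes e≡p) = begin
    removeFrom ρ (i , saturate M p) (i , e) ≡⟨ removeFrom-at ρ (cong (i ,_) (sameColumn e≡p)) ⟩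
    ρ (i , e) ∸ 1                           ≡⟨ cong (_∸ 1) (ρ≡h e) ⟩
    h (toℕ e) ∸ 1                           ≡⟨ sym (lowerAt-at p (toℕ e) h e≡p) ⟩
    lowerAt p h (toℕ e)                     ∎
  byColumn (no e≢p) = begin
    removeFrom ρ (i , saturate M p) (i , e) ≡⟨ removeFrom-off ρ (e≢p ∘ columnOf p≤M) ⟩
    ρ (i , e)                               ≡⟨ ρ≡h e ⟩
    h (toℕ e)                               ≡⟨ sym (lowerAt-off p (toℕ e) h e≢p) ⟩
    lowerAt p h (toℕ e)                     ∎

removeFrom-top : ∀ {M} f g p → p ≤ M →
  removeFrom (byRows {suc M} f g) (zero , saturate M p) ≗ᵨ byRows (lowerAt p f) g
removeFrom-top     f g p p≤M (zero     , e) = removeFrom-inRow (byRows f g) zero p≤M f (λ _ → refl) e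
removeFrom-top {M} f g p p≤M (suc zero , e) = removeFrom-off (byRows f g) {zero , saturate M p} {suc zero , e} (λ ())

removeFrom-bottom : ∀ {M} f g p → p ≤ M →
  removeFrom (byRows {suc M} f g) (suc zero , saturate M p) ≗ᵨ byRows f (lowerAt p g)
removeFrom-bottom {M} f g p p≤M (zero     , e) = removeFrom-off (byRows f g) {suc zero , saturate M p} {zero , e} (λ ())
removeFrom-bottom     f g p p≤M (suc zero , e) = removeFrom-inRow (byRows f g) (suc zero) p≤M g (λ _ → refl) e

-- The densities met while reading a tableau of density rowDensity (K+1).
-- Entries fill the top row from left to right, one per column, and the bottom
-- row from left to right, K per column.
module RowStates (K : ℕ) where

  -- Top row after t entries: columns < t are full, columns ≥ t still hold 1.
  topLeft : ℕ → ℕ → ℕ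
  topLeft zero    x       = 1
  topLeft (suc t) zero    = 0
  topLeft (suc t) (suc x) = topLeft t x

  topLeft-below : ∀ {t x} → x < t → topLeft t x ≡ 0
  topLeft-below {suc t} {zero}  _         = refl
  topLeft-below {suc t} {suc x} (s≤s x<t) = topLeft-below x<t

  topLeft-above : ∀ {t x} → t ≤ x → topLeft t x ≡ 1
  topLeft-above {zero}                z≤n       = refl
  topLeft-above {suc t} {suc x}       (s≤s t≤x) = topLeft-above t≤x

  topLeft-empty : ∀ t x → topLeft t x ≡ 0 → x < t
  topLeft-empty (suc t) zero    _  = s≤s z≤n
  topLeft-empty (suc t) (suc x) eq = s≤s (topLeft-empty t x eq)

  topLeft-room : ∀ t x → 1 ≤ topLeft t x → t ≤ x
  topLeft-room zero    x       _    = z≤n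
  topLeft-room (suc t) (suc x) room = s≤s (topLeft-room t x room)

  topLeft-step : ∀ t x → lowerAt t (topLeft t) x ≡ topLeft (suc t) x
  topLeft-step t x with <-cmp x t
  ... | tri< x<t _ _  = trans (lowerAt-off t x _ (<⇒≢ x<t))
                          (trans (topLeft-below x<t) (sym (topLeft-below (m<n⇒m<1+n x<t))))
  ... | tri≈ _ refl _ = trans (lowerAt-at x x (topLeft x) refl)
                          (trans (cong (_∸ 1) (topLeft-above {x} {x} ≤-refl)) (sym (topLeft-below {suc x} {x} ≤-refl)))
  ... | tri> _ _ x>t  = trans (lowerAt-off t x _ (>⇒≢ x>t))
                          (trans (topLeft-above (<⇒≤ x>t)) (sym (topLeft-above x>t)))

  -- Bottom row after c full columns and j entries of column c:
  -- columns < c are full, column c holds K − j, columns > c hold K.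
  botLeft : ℕ → ℕ → ℕ → ℕ
  botLeft zero    j zero    = K ∸ j
  botLeft zero    j (suc x) = K
  botLeft (suc c) j zero    = 0
  botLeft (suc c) j (suc x) = botLeft c j x

  botLeft-below : ∀ {c x} j → x < c → botLeft c j x ≡ 0
  botLeft-below {suc c} {zero}  j _         = refl
  botLeft-below {suc c} {suc x} j (s≤s x<c) = botLeft-below j x<c

  botLeft-at : ∀ c j → botLeft c j c ≡ K ∸ j
  botLeft-at zero    j = refl
  botLeft-at (suc c) j = botLeft-at c j

  botLeft-above : ∀ {c x} j → c < x → botLeft c j x ≡ K
  botLeft-above {zero}  {suc x} j _         = refl
  botLeft-above {suc c} {suc x} j (s≤s c<x) = botLeft-above j c<x

  botLeft-≤K : ∀ c j x → botLeft c j x ≤ K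
  botLeft-≤K zero    j zero    = m∸n≤m K j
  botLeft-≤K zero    j (suc x) = ≤-refl
  botLeft-≤K (suc c) j zero    = z≤n
  botLeft-≤K (suc c) j (suc x) = botLeft-≤K c j x

  botLeft-room : ∀ c j x → 1 ≤ botLeft c j x → c ≤ x
  botLeft-room zero    j x       _    = z≤n
  botLeft-room (suc c) j (suc x) room = s≤s (botLeft-room c j x room)

  botLeft-empty : ∀ c j x → j < K → botLeft c j x ≡ 0 → x < c
  botLeft-empty zero    j zero    j<K eq = ⊥-elim (<⇒≱ j<K (m∸n≡0⇒m≤n eq))
  botLeft-empty zero    j (suc x) j<K eq = ⊥-elim (<⇒≱ j<K (subst (_≤ j) (sym eq) z≤n))
  botLeft-empty (suc c) j zero    _   _  = s≤s z≤n
  botLeft-empty (suc c) j (suc x) j<K eq = s≤s (botLeft-empty c j x j<K eq)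

  botLeft-step : ∀ c j x → lowerAt c (botLeft c j) x ≡ botLeft c (suc j) x
  botLeft-step c j x with <-cmp x c
  ... | tri< x<c _ _ = trans (lowerAt-off c x _ (<⇒≢ x<c))
                         (trans (botLeft-below j x<c) (sym (botLeft-below (suc j) x<c)))
  ... | tri≈ _ refl _ = begin
        lowerAt x (botLeft x j) x ≡⟨ lowerAt-at x x (botLeft x j) refl ⟩
        botLeft x j x ∸ 1         ≡⟨ cong (_∸ 1) (botLeft-at x j) ⟩
        K ∸ j ∸ 1                 ≡⟨ ∸-+-assoc K j 1 ⟩
        K ∸ (j + 1)               ≡⟨ cong (K ∸_) (+-comm j 1) ⟩
        K ∸ suc j                 ≡⟨ sym (botLeft-at x (suc j)) ⟩
        botLeft x (suc j) x       ∎
  ... | tri> _ _ x>c = trans (lowerAt-off c x _ (>⇒≢ x>c))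
                         (trans (botLeft-above j x>c) (sym (botLeft-above (suc j) x>c)))

  botLeft-carry : ∀ c x → botLeft c K x ≡ botLeft (suc c) 0 x
  botLeft-carry zero    zero          = n∸n≡0 K
  botLeft-carry zero    (suc zero)    = refl
  botLeft-carry zero    (suc (suc x)) = refl
  botLeft-carry (suc c) zero          = refl
  botLeft-carry (suc c) (suc x)       = botLeft-carry c x

  -- Progress (c , j) in the bottom row: c full columns, j entries in column c.
  Progress : Set
  Progress = ℕ × ℕ

  placed : Progress → ℕ
  placed (c , j) = c * K + j

  next : Progress → Progress
  next (c , j) with suc j ≟ K
  ... | yes _ = suc c , 0
  ... | no  _ = c , suc j

  botLeft-next : ∀ c j x → botLeft c (suc j) x ≡ botLeft (proj₁ (next (c , j))) (proj₂ (next (c , j))) x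
  botLeft-next c j x with suc j ≟ K
  ... | yes j+1≡K = trans (cong (λ z → botLeft c z x) j+1≡K) (botLeft-carry c x)
  ... | no _      = refl

  -- While column c is being filled (j < K), next records one more placed entry
  -- and keeps j < K, except that a completed column is recorded as j = 0.
  next-placed : ∀ c j → j < K → placed (next (c , j)) ≡ suc (placed (c , j))
  next-placed c j j<K with suc j ≟ K
  ... | yes refl = column-completed j c
    where column-completed : ∀ j c → suc c * suc j + 0 ≡ suc (c * suc j + j)
          column-completed = solve-∀
  ... | no _     = +-suc (c * K) j

  next-partial : ∀ c j → j < K → proj₂ (next (c , j)) < K ⊎ proj₂ (next (c , j)) ≡ 0
  next-partial c j j<K with suc j ≟ K
  ... | yes _     = inj₂ refl
  ... | no j+1≢K  = inj₁ (≤∧≢⇒< j<K j+1≢K)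

module ColumnArithmetic (K : ℕ) where

  capacity≤placed : ∀ {t c} j → t ≤ c → t * K ≤ c * K + j
  capacity≤placed {t} {c} j t≤c = ≤-trans (*-monoˡ-≤ K t≤c) (m≤m+n (c * K) j)

  placed<capacity : ∀ {t c j} → c < t → j < K → c * K + j < t * K
  placed<capacity {t} {c} {j} c<t j<K =
    <-≤-trans (+-monoʳ-< (c * K) j<K) (subst (_≤ t * K) (+-comm K (c * K)) (*-monoˡ-≤ K c<t))

-- The reading words of the tableaux of shape (M+1)² and density
-- rowDensity (K+1), generated by choosing at each step whether the next entry
-- goes to the top or to the bottom row.
module Enumeration (K M : ℕ) where
  open RowStates K
  open ColumnArithmetic K
  open Raney K using (k; R)

  m : ℕ
  m = suc M

  state : ℕ → Progress → Density m
  state t (c , j) = byRows (topLeft t) (botLeft c j)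

  topCell : ℕ → Cell m
  topCell t = zero , saturate M t

  botCell : Progress → Cell m
  botCell (c , _) = suc zero , saturate M c

  state-top : ∀ t b → t ≤ M → removeFrom (state t b) (topCell t) ≗ᵨ state (suc t) b
  state-top t (c , j) t≤M y =
    trans (removeFrom-top (topLeft t) (botLeft c j) t t≤M y) (byRows-cong (topLeft-step t) (λ _ → refl) y)

  state-bottom : ∀ t b → proj₁ b ≤ M → removeFrom (state t b) (botCell b) ≗ᵨ state t (next b)
  state-bottom t (c , j) c≤M y =
    trans (removeFrom-bottom (topLeft t) (botLeft c j) c c≤M y)
          (byRows-cong (λ _ → refl) (λ x → trans (botLeft-step c j x) (botLeft-next c j x)) y)

  topCell-room : ∀ t b → t ≤ M → state t b (topCell t) ≡ 1
  topCell-room t b t≤M = trans (cong (topLeft t) (toℕ-saturate M t t≤M)) (topLeft-above {t} ≤-refl)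

  botCell-room : ∀ t c j → c ≤ M → state t (c , j) (botCell (c , j)) ≡ K ∸ j
  botCell-room t c j c≤M = trans (cong (botLeft c j) (toℕ-saturate M c c≤M)) (botLeft-at c j)

  topCell-ready : ∀ t b → t ≤ M → ∀ y → y ⋖ topCell t → state t b y ≡ 0
  topCell-ready t b t≤M (zero     , e) (inj₁ (_ , eq)) =
    topLeft-below (≤-reflexive (trans (sym eq) (toℕ-saturate M t t≤M)))
  topCell-ready t b t≤M (zero     , e) (inj₂ (() , _))
  topCell-ready t b t≤M (suc zero , e) (inj₁ (() , _))
  topCell-ready t b t≤M (suc zero , e) (inj₂ (() , _))

  botCell-ready : ∀ t c j → c < t → c ≤ M → ∀ y → y ⋖ botCell (c , j) → state t (c , j) y ≡ 0
  botCell-ready t c j c<t c≤M (zero     , e) (inj₁ (() , _))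
  botCell-ready t c j c<t c≤M (zero     , e) (inj₂ (_ , e≡c)) =
    topLeft-below (subst (_< t) (sym (trans (cong toℕ e≡c) (toℕ-saturate M c c≤M))) c<t)
  botCell-ready t c j c<t c≤M (suc zero , e) (inj₁ (_ , eq)) =
    botLeft-below j (≤-reflexive (trans (sym eq) (toℕ-saturate M c c≤M)))
  botCell-ready t c j c<t c≤M (suc zero , e) (inj₂ (() , _))

  -- Invariant of the reachable states: t top entries are placed and a remain;
  -- the slack d is the number of bottom entries that may be placed before the
  -- next top entry; column c of the bottom row is being filled (j < K unless K = 0).
  record Invariant (d a t : ℕ) (b : Progress) : Set where
    constructor invariant
    field
      tops    : t + a ≡ m
      slack   : d + placed b ≡ t * K
      partial : proj₂ b < K ⊎ proj₂ b ≡ 0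
  open Invariant

  filling : ∀ {j} → 1 ≤ K → j < K ⊎ j ≡ 0 → j < K
  filling _   (inj₁ j<K)  = j<K
  filling 1≤K (inj₂ refl) = 1≤K

  slack⇒bottom : ∀ {d a t c j} → Invariant (suc d) a t (c , j) → j < K × c < t × c ≤ M
  slack⇒bottom {d} {a} {t} {c} {j} inv = j<K , c<t , s≤s⁻¹ (<-≤-trans c<t t≤m)
    where
    K≢0 : K ≢ 0
    K≢0 K≡0 = 0≢1+n (sym (trans (slack inv) (trans (cong (t *_) K≡0) (*-zeroʳ t))))
    j<K : j < K
    j<K = filling (n≢0⇒n>0 K≢0) (partial inv)
    c<t : c < t
    c<t = ≰⇒> (λ t≤c → <⇒≱ (subst (c * K + j <_) (slack inv) (s≤s (m≤n+m _ d))) (capacity≤placed j t≤c))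
    t≤m : t ≤ m
    t≤m = subst (t ≤_) (tops inv) (m≤m+n t a)

  no-slack : ∀ {a t c j} → Invariant 0 a t (c , j) → c < t → j < K → ⊥
  no-slack inv c<t j<K = <-irrefl (slack inv) (placed<capacity c<t j<K)

  top-left : ∀ {d a t b} → Invariant d (suc a) t b → t ≤ M
  top-left {a = a} {t} inv = ≤-trans (m≤m+n t a) (≤-reflexive (suc-injective (trans (sym (+-suc t a)) (tops inv))))

  top-done : ∀ {d t b} → Invariant d 0 t b → t ≡ m
  top-done {t = t} inv = trans (sym (+-identityʳ t)) (tops inv)

  Invariant-top : ∀ {d a t b} → Invariant d (suc a) t b → Invariant (d + K) a (suc t) b
  Invariant-top {d} {a} {t} {b} (invariant tops slack partial) =
    invariant (trans (sym (+-suc t a)) tops) (trans (reorder d K (placed b)) (cong (K +_) slack)) partial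
    where reorder : ∀ d K x → d + K + x ≡ K + (d + x)
          reorder = solve-∀

  Invariant-bottom : ∀ {d a t c j} → Invariant (suc d) a t (c , j) → Invariant d a t (next (c , j))
  Invariant-bottom {d} {c = c} {j} inv@(invariant tops slack _) =
    invariant tops (trans (cong (d +_) (next-placed c j j<K)) (trans (+-suc d _) slack)) (next-partial c j j<K)
    where j<K = proj₁ (slack⇒bottom inv)

  Invariant-done : ∀ {t c j} → Invariant 0 0 t (c , j) → ∀ y → state t (c , j) y ≡ 0
  Invariant-done {t} inv (zero , e) = topLeft-below (subst (toℕ e <_) (sym (top-done inv)) (toℕ<n e))
  Invariant-done {t} {c} {j} inv (suc zero , e) with K ≟ 0
  ... | yes K≡0 = n≤0⇒n≡0 (subst (botLeft c j (toℕ e) ≤_) K≡0 (botLeft-≤K c j (toℕ e)))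
  ... | no K≢0  = botLeft-below j (<-≤-trans (subst (toℕ e <_) (sym (top-done inv)) (toℕ<n e)) t≤c)
    where
    t≤c : t ≤ c
    t≤c = ≮⇒≥ (λ c<t → no-slack inv c<t (filling (n≢0⇒n>0 K≢0) (partial inv)))

  mutual
    words : (ℓ d a t : ℕ) → Progress → List (Vec (Cell m) ℓ)
    words zero    zero    zero    t b = [] ∷ []
    words zero    zero    (suc a) t b = []
    words zero    (suc d) a       t b = []
    words (suc ℓ) d       a       t b = bottomFirst ℓ d a t b ++ topFirst ℓ d a t b

    bottomFirst : (ℓ d a t : ℕ) → Progress → List (Vec (Cell m) (suc ℓ))
    bottomFirst ℓ zero    a t b = []
    bottomFirst ℓ (suc d) a t b = map (botCell b ∷_) (words ℓ d a t (next b))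

    topFirst : (ℓ d a t : ℕ) → Progress → List (Vec (Cell m) (suc ℓ))
    topFirst ℓ d zero    t b = []
    topFirst ℓ d (suc a) t b = map (topCell t ∷_) (words ℓ (d + K) a (suc t) b)

  -- Each step shrinks the remaining number d + a·k of entries by one, and the
  -- recursion of words is that of R.
  words-length : ∀ ℓ d a t b → ℓ ≡ d + a * k → length (words ℓ d a t b) ≡ R (suc d) a
  words-length zero    zero    zero    t b _  = refl
  words-length (suc ℓ) zero    (suc a) t b eq =
    trans (length-map _ (words ℓ K a (suc t) b)) (words-length ℓ K a (suc t) b (suc-injective eq))
  words-length (suc ℓ) (suc d) zero    t b eq = begin
    length (bottomFirst ℓ (suc d) zero t b ++ [])  ≡⟨ cong length (++-identityʳ (bottomFirst ℓ (suc d) zero t b)) ⟩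
    length (bottomFirst ℓ (suc d) zero t b)        ≡⟨ length-map _ (words ℓ d zero t (next b)) ⟩
    length (words ℓ d zero t (next b))             ≡⟨ words-length ℓ d zero t (next b) (suc-injective eq) ⟩
    R (suc d) zero                                 ∎
  words-length (suc ℓ) (suc d) (suc a) t b eq = begin
    length (bottomFirst ℓ (suc d) (suc a) t b ++ topFirst ℓ (suc d) (suc a) t b)
      ≡⟨ length-++ (bottomFirst ℓ (suc d) (suc a) t b) ⟩
    length (bottomFirst ℓ (suc d) (suc a) t b) + length (topFirst ℓ (suc d) (suc a) t b)
      ≡⟨ cong₂ _+_ (length-map _ (words ℓ d (suc a) t (next b))) (length-map _ (words ℓ (suc d + K) a (suc t) b)) ⟩
    length (words ℓ d (suc a) t (next b)) + length (words ℓ (suc d + K) a (suc t) b)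
      ≡⟨ cong₂ _+_ (words-length ℓ d (suc a) t (next b) (suc-injective eq))
                   (words-length ℓ (suc d + K) a (suc t) b (trans (suc-injective eq) (remaining d K a))) ⟩
    R (suc (suc d)) (suc a) ∎
    where remaining : ∀ d K a → d + suc a * suc K ≡ suc d + K + a * suc K
          remaining = solve-∀

  words-unique : ∀ ℓ d a t b → Unique (words ℓ d a t b)
  words-unique zero    zero    zero    t b = ListAll.[] AllPairs.∷ AllPairs.[]
  words-unique zero    zero    (suc a) t b = AllPairs.[]
  words-unique zero    (suc d) a       t b = AllPairs.[]
  words-unique (suc ℓ) d       a       t b = Unique.++⁺ (bottom-unique d) (top-unique a) (disjoint d a)
    where
    bottom-unique : ∀ d → Unique (bottomFirst ℓ d a t b)
    bottom-unique zero    = AllPairs.[]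
    bottom-unique (suc d) = Unique.map⁺ ∷-injectiveʳ (words-unique ℓ d a t (next b))
    top-unique : ∀ a → Unique (topFirst ℓ d a t b)
    top-unique zero    = AllPairs.[]
    top-unique (suc a) = Unique.map⁺ ∷-injectiveʳ (words-unique ℓ (d + K) a (suc t) b)
    -- the two parts differ in the row of the first letter
    disjoint : ∀ d a {T} → ¬ (T ∈ bottomFirst ℓ d a t b × T ∈ topFirst ℓ d a t b)
    disjoint (suc d) (suc a) (T∈bottom , T∈top) with ∈-map⁻ _ T∈bottom | ∈-map⁻ _ T∈top
    ... | _ , _ , refl | _ , _ , ()

  top-first : ∀ t b (e : Fin m) → 1 ≤ state t b (zero , e) →
    (∀ y → y ⋖ (zero , e) → state t b y ≡ 0) → toℕ e ≡ t
  top-first t b e room full = ≤-antisym (left-full e full) (topLeft-room t (toℕ e) room)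
    where
    -- the left neighbour of the first letter must already be full
    left-full : ∀ e′ → (∀ y → y ⋖ (zero , e′) → state t b y ≡ 0) → toℕ e′ ≤ t
    left-full zero    _     = z≤n
    left-full (suc f) full′ = subst (λ z → suc z ≤ t) (toℕ-inject₁ f)
      (topLeft-empty t _ (full′ (zero , inject₁ f) (inj₁ (refl , cong suc (sym (toℕ-inject₁ f))))))

  bottom-first : ∀ {d a} t c j (e : Fin m) → Invariant d a t (c , j) → 1 ≤ state t (c , j) (suc zero , e) →
    (∀ y → y ⋖ (suc zero , e) → state t (c , j) y ≡ 0) → toℕ e ≡ c × c < t × j < K
  bottom-first t c j e inv room full = e≡c , c<t , j<K
    where
    j<K : j < K
    j<K = filling (≤-trans room (botLeft-≤K c j (toℕ e))) (partial inv)
    left-full : ∀ e′ → (∀ y → y ⋖ (suc zero , e′) → state t (c , j) y ≡ 0) → toℕ e′ ≤ c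
    left-full zero    _     = z≤n
    left-full (suc f) full′ = subst (λ z → suc z ≤ c) (toℕ-inject₁ f)
      (botLeft-empty c j _ j<K (full′ (suc zero , inject₁ f) (inj₁ (refl , cong suc (sym (toℕ-inject₁ f))))))
    e≡c : toℕ e ≡ c
    e≡c = ≤-antisym (left-full e full) (botLeft-room c j (toℕ e) room)
    -- the cell above the first letter must already be full
    c<t : c < t
    c<t = subst (_< t) e≡c (topLeft-empty t (toℕ e) (full (zero , e) (inj₂ (refl , refl))))

  mutual
    words-sound : ∀ ℓ d a t b → Invariant d a t b → ∀ T → T ∈ words ℓ d a t b → Reading (state t b) T
    words-sound zero    zero zero t (c , j) inv [] (here refl) = Invariant-done inv
    words-sound (suc ℓ) d    a    t b       inv T  T∈ with ∈-++⁻ (bottomFirst ℓ d a t b) T∈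
    ... | inj₁ T∈bottom = bottomFirst-sound ℓ d a t b inv T T∈bottom
    ... | inj₂ T∈top    = topFirst-sound ℓ d a t b inv T T∈top

    bottomFirst-sound : ∀ ℓ d a t b → Invariant d a t b → ∀ T → T ∈ bottomFirst ℓ d a t b →
      Reading (state t b) T
    bottomFirst-sound ℓ (suc d) a t (c , j) inv T T∈ with ∈-map⁻ _ T∈ | slack⇒bottom inv
    ... | T′ , T′∈ , refl | j<K , c<t , c≤M =
      subst (1 ≤_) (sym (botCell-room t c j c≤M)) (m<n⇒0<n∸m j<K) ,
      botCell-ready t c j c<t c≤M ,
      Reading-resp (λ y → sym (state-bottom t (c , j) c≤M y)) T′
        (words-sound ℓ d a t (next (c , j)) (Invariant-bottom inv) T′ T′∈)

    topFirst-sound : ∀ ℓ d a t b → Invariant d a t b → ∀ T → T ∈ topFirst ℓ d a t b → Reading (state t b) T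
    topFirst-sound ℓ d (suc a) t b inv T T∈ with ∈-map⁻ _ T∈
    ... | T′ , T′∈ , refl =
      ≤-reflexive (sym (topCell-room t b t≤M)) ,
      topCell-ready t b t≤M ,
      Reading-resp (λ y → sym (state-top t b t≤M y)) T′
        (words-sound ℓ (d + K) a (suc t) b (Invariant-top inv) T′ T′∈)
      where t≤M = top-left inv

  mutual
    words-complete : ∀ ℓ d a t b → Invariant d a t b → ∀ T → Reading (state t b) T → T ∈ words ℓ d a t b
    words-complete zero    zero    zero    t b       inv [] _     = here refl
    words-complete zero    zero    (suc a) t b       inv [] empty =
      ⊥-elim (0≢1+n (trans (sym (empty (topCell t))) (topCell-room t b (top-left inv))))
    words-complete zero    (suc d) a       t (c , j) inv [] empty with slack⇒bottom inv
    ... | j<K , _ , c≤M =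
      ⊥-elim (<⇒≱ j<K (m∸n≡0⇒m≤n (trans (sym (botCell-room t c j c≤M)) (empty (botCell (c , j))))))
    words-complete (suc ℓ) d a t b inv ((zero , e) ∷ T) r =
      ∈-++⁺ʳ (bottomFirst ℓ d a t b) (topFirst-complete ℓ d a t b inv e T r)
    words-complete (suc ℓ) d a t b inv ((suc zero , e) ∷ T) r =
      ∈-++⁺ˡ (bottomFirst-complete ℓ d a t b inv e T r)

    topFirst-complete : ∀ ℓ d a t b → Invariant d a t b → ∀ e T → Reading (state t b) ((zero , e) ∷ T) →
      (zero , e) ∷ T ∈ topFirst ℓ d a t b
    topFirst-complete ℓ d zero t b inv e T (room , full , _) =
      ⊥-elim (<-irrefl (trans (top-first t b e room full) (top-done inv)) (toℕ<n e))
    topFirst-complete ℓ d (suc a) t b inv e T (room , full , rest)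
      with refl ← sameColumn (top-first t b e room full) =
      ∈-map⁺ _ (words-complete ℓ (d + K) a (suc t) b (Invariant-top inv) T
                  (Reading-resp (state-top t b (top-left inv)) T rest))

    bottomFirst-complete : ∀ ℓ d a t b → Invariant d a t b → ∀ e T → Reading (state t b) ((suc zero , e) ∷ T) →
      (suc zero , e) ∷ T ∈ bottomFirst ℓ d a t b
    bottomFirst-complete ℓ zero a t (c , j) inv e T (room , full , _) with bottom-first t c j e inv room full
    ... | _ , c<t , j<K = ⊥-elim (no-slack inv c<t j<K)
    bottomFirst-complete ℓ (suc d) a t (c , j) inv e T (room , full , rest)
      with refl ← sameColumn (proj₁ (bottom-first t c j e inv room full)) =
      ∈-map⁺ _ (words-complete ℓ d a t (next (c , j)) (Invariant-bottom inv) T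
                  (Reading-resp (state-bottom t (c , j) c≤M) T rest))
      where c≤M = proj₂ (proj₂ (slack⇒bottom inv))

concatUpTo : ∀ {X : Set} → ℕ → (ℕ → List X) → List X
concatUpTo zero    f = f 0
concatUpTo (suc n) f = f 0 ++ concatUpTo n (f ∘ suc)

∈-concatUpTo⁺ : ∀ {X : Set} {x : X} n (f : ℕ → List X) {a} → a ≤ n → x ∈ f a → x ∈ concatUpTo n f
∈-concatUpTo⁺ zero    f {zero}  _         x∈ = x∈
∈-concatUpTo⁺ (suc n) f {zero}  _         x∈ = ∈-++⁺ˡ x∈
∈-concatUpTo⁺ (suc n) f {suc a} (s≤s a≤n) x∈ = ∈-++⁺ʳ (f 0) (∈-concatUpTo⁺ n (f ∘ suc) a≤n x∈)

∈-concatUpTo⁻ : ∀ {X : Set} {x : X} n (f : ℕ → List X) → x ∈ concatUpTo n f → ∃ λ a → a ≤ n × x ∈ f a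
∈-concatUpTo⁻ zero    f x∈ = 0 , z≤n , x∈
∈-concatUpTo⁻ (suc n) f x∈ with ∈-++⁻ (f 0) x∈
... | inj₁ x∈f0 = 0 , z≤n , x∈f0
... | inj₂ x∈rest with ∈-concatUpTo⁻ n (f ∘ suc) x∈rest
...   | a , a≤n , x∈fa = suc a , s≤s a≤n , x∈fa

concatUpTo-unique : ∀ {X : Set} n (f : ℕ → List X) → (∀ a → Unique (f a)) →
  (∀ {x} a b → x ∈ f a → x ∈ f b → a ≡ b) → Unique (concatUpTo n f)
concatUpTo-unique zero    f unique _        = unique 0
concatUpTo-unique (suc n) f unique disjoint =
  Unique.++⁺ (unique 0)
    (concatUpTo-unique n (f ∘ suc) (unique ∘ suc)
      (λ a b x∈ x∈′ → suc-injective (disjoint (suc a) (suc b) x∈ x∈′)))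
    (λ (x∈f0 , x∈rest) → let (a , _ , x∈fa) = ∈-concatUpTo⁻ n (f ∘ suc) x∈rest
                          in 0≢1+n (disjoint 0 (suc a) x∈f0 x∈fa))

length-concatUpTo : ∀ {X : Set} n (f : ℕ → List X) → length (concatUpTo n f) ≡ sumTo n (length ∘ f)
length-concatUpTo zero    f = refl
length-concatUpTo (suc n) f = trans (length-++ (f 0)) (cong (length (f 0) +_) (length-concatUpTo n (f ∘ suc)))

length-cartesianProductWith : ∀ {A B C : Set} (f : A → B → C) xs ys →
  length (cartesianProductWith f xs ys) ≡ length xs * length ys
length-cartesianProductWith f []       ys = refl
length-cartesianProductWith f (x ∷ xs) ys =
  trans (length-++ (map (f x) ys)) (cong₂ _+_ (length-map (f x) ys) (length-cartesianProductWith f xs ys))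

sum-tabulate-const : ∀ n v → Vec.sum (tabulate {n = n} (λ _ → v)) ≡ n * v
sum-tabulate-const zero    v = refl
sum-tabulate-const (suc n) v = cong (v +_) (sum-tabulate-const n v)

module Tuples (K : ℕ) where
  open Raney K using (k; R; R-convolution)
  open RowStates K using (botLeft)
  open ReadingCharacterisation

  ρ : (m : ℕ) → Density m
  ρ m = rowDensity k m

  -- Each column holds 1 + K = k entries.
  total-ρ : ∀ m → total m (ρ m) ≡ 0 + m * k
  total-ρ m = trans (cong₂ _+_ (sum-tabulate-const m 1) (cong (_+ 0) (sum-tabulate-const m K))) (per-column m K)
    where per-column : ∀ m K → m * 1 + (m * K + 0) ≡ 0 + m * suc K
          per-column = solve-∀

  initial-state : ∀ M → Enumeration.state K M 0 (0 , 0) ≗ᵨ ρ (suc M)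
  initial-state M (zero     , x) = refl
  initial-state M (suc zero , x) = fresh (toℕ x)
    where fresh : ∀ x → botLeft 0 0 x ≡ K
          fresh zero    = refl
          fresh (suc x) = refl

  initial : ∀ M → Enumeration.Invariant K M 0 (suc M) 0 (0 , 0)
  initial M = Enumeration.invariant refl refl (inj₂ refl)

  tableaux : (m : ℕ) → List (Vec (Cell m) (total m (ρ m)))
  tableaux zero    = [] ∷ []
  tableaux (suc M) = Enumeration.words K M _ 0 (suc M) 0 (0 , 0)

  tableaux-sound : ∀ m T → T ∈ tableaux m → IsSVT m (ρ m) T
  tableaux-sound zero    [] _  = (λ ()) , (λ _ _ _ _ _ ())
  tableaux-sound (suc M) T T∈ =
    reading⇒svt (ρ (suc M)) T
      (Reading-resp (initial-state M) T (Enumeration.words-sound K M _ 0 (suc M) 0 (0 , 0) (initial M) T T∈))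

  tableaux-complete : ∀ m T → IsSVT m (ρ m) T → T ∈ tableaux m
  tableaux-complete zero    [] _   = here refl
  tableaux-complete (suc M) T svt  =
    Enumeration.words-complete K M _ 0 (suc M) 0 (0 , 0) (initial M) T
      (Reading-resp (λ y → sym (initial-state M y)) T (svt⇒reading (ρ (suc M)) T svt))

  tableaux-unique : ∀ m → Unique (tableaux m)
  tableaux-unique zero    = ListAll.[] AllPairs.∷ AllPairs.[]
  tableaux-unique (suc M) = Enumeration.words-unique K M _ 0 (suc M) 0 (0 , 0)

  tableaux-length : ∀ m → length (tableaux m) ≡ R 1 m
  tableaux-length zero    = refl
  tableaux-length (suc M) = Enumeration.words-length K M _ 0 (suc M) 0 (0 , 0) (total-ρ (suc M))

  mutual
    tuples : (r n : ℕ) → List (TupleData k r)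
    tuples zero    zero    = [] ∷ []
    tuples zero    (suc n) = []
    tuples (suc r) n       = concatUpTo n (withFirst r n)

    withFirst : (r n a : ℕ) → List (TupleData k (suc r))
    withFirst r n a = cartesianProductWith (λ T rest → (a , T) ∷ rest) (tableaux a) (tuples r (n ∸ a))

  tuples-sound : ∀ r n t → t ∈ tuples r n → Admissible k r n t
  tuples-sound zero    zero [] (here refl) = VecAll.[] , refl
  tuples-sound (suc r) n t t∈ with ∈-concatUpTo⁻ n _ t∈
  ... | a , a≤n , t∈a with ∈-cartesianProductWith⁻ _ (tableaux a) (tuples r (n ∸ a)) t∈a
  ...   | T , rest , T∈ , rest∈ , refl with tuples-sound r (n ∸ a) rest rest∈
  ...     | svts , sizes = (tableaux-sound a T T∈ VecAll.∷ svts) , trans (cong (a +_) sizes) (m+[n∸m]≡n a≤n)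

  tuples-complete : ∀ r n t → Admissible k r n t → t ∈ tuples r n
  tuples-complete zero    zero    []              _                    = here refl
  tuples-complete (suc r) n       ((a , T) ∷ rest) (svt VecAll.∷ svts , sizes) =
    ∈-concatUpTo⁺ n _ (subst (a ≤_) sizes (m≤m+n a _))
      (∈-cartesianProductWith⁺ _ (tableaux-complete a T svt)
        (tuples-complete r (n ∸ a) rest (svts , trans (sym (m+n∸m≡n a _)) (cong (_∸ a) sizes))))

  tuples-unique : ∀ r n → Unique (tuples r n)
  tuples-unique zero    zero    = ListAll.[] AllPairs.∷ AllPairs.[]
  tuples-unique zero    (suc n) = AllPairs.[]
  tuples-unique (suc r) n       = concatUpTo-unique n _
    (λ a → Unique.cartesianProductWith⁺ _ prepend-injective (tableaux-unique a) (tuples-unique r (n ∸ a)))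
    shape-determined
    where
    prepend-injective : ∀ {a} {T T′ : Vec (Cell a) (total a (ρ a))} {rest rest′ : TupleData k r} →
      _≡_ {A = TupleData k (suc r)} ((a , T) ∷ rest) ((a , T′) ∷ rest′) → T ≡ T′ × rest ≡ rest′
    prepend-injective refl = refl , refl
    shape-determined : ∀ {t} a b → t ∈ withFirst r n a → t ∈ withFirst r n b → a ≡ b
    shape-determined a b t∈a t∈b
      with ∈-cartesianProductWith⁻ _ (tableaux a) _ t∈a | ∈-cartesianProductWith⁻ _ (tableaux b) _ t∈b
    ... | _ , _ , _ , _ , refl | _ , _ , _ , _ , refl = refl

  tuples-length : ∀ r n → length (tuples r n) ≡ R r n
  tuples-length zero    zero    = refl
  tuples-length zero    (suc n) = refl
  tuples-length (suc r) n       = begin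
    length (tuples (suc r) n)
      ≡⟨ length-concatUpTo n _ ⟩
    sumTo n (length ∘ withFirst r n)
      ≡⟨ sumTo-cong n (λ a → trans (length-cartesianProductWith _ (tableaux a) (tuples r (n ∸ a)))
                                    (cong₂ _*_ (tableaux-length a) (tuples-length r (n ∸ a)))) ⟩
    sumTo n (λ a → R 1 a * R r (n ∸ a))
      ≡⟨ R-convolution 1 r n ⟩
    R (suc r) n ∎

-- The admissible tuples are listed by tuples r n; their number R(r, n) satisfies
-- the Raney formula.
proposition2p1 : (k r n : ℕ) → 1 ≤ k → 1 ≤ r →
    Σ ℕ λ N → CountIs k r n N × (k * n + r) * N ≡ r * ((k * n + r) C n)
proposition2p1 zero    r n () _
proposition2p1 (suc K) r n _  _ =
  length L ,
  (L , tuples-unique r n , ListAll.tabulate (tuples-sound r n _) , tuples-complete r n , refl) ,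
  (begin
    (suc K * n + r) * length L ≡⟨ cong ((suc K * n + r) *_) (tuples-length r n) ⟩
    (suc K * n + r) * R r n    ≡⟨ R-closed-form n r ⟩
    r * ((suc K * n + r) C n)  ∎)
  where
  open Tuples K
  open Raney K using (R; R-closed-form)
  L = tuples r n
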